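{- Let $G$ be an interval colorable graph, and let $H$ be a graph with $|V(H)|=n$ that has an interval coloring $\alpha_H$ such that $L=USE(V(H),\alpha_H)$ is continuous. Then the composition $G[H]$ is interval colorable, and moreover $$w(G[H])\le w(G)\cdot n+\overline L\quad\text{and}\quad W(G[H])\ge W(G)\cdot n+\overline L,$$ where $\overline L$ is the largest element of $L$.
   Context: All graphs are finite, undirected, without loops or multiple edges. A proper edge-coloring of $G$ with consecutive integers $c_1,\ldots,c_t$ is an interval $t$-coloring if all $t$ colors are used and for every vertex $v$ the spectrum $S(v,\alpha)$ (set of colors on edges incident to $v$) is an interval of integers. $G$ is interval colorable if it has an interval $t$-coloring for some positive integer $t$; for such $G$, $w(G)$ and $W(G)$ denote the smallest and largest $t$ for which $G$ has an interval $t$-coloring. $\overline S(v,\alpha)=\max S(v,\alpha)$. For $V'\subseteq V(G)$, $USE(V',\alpha)$ is the sequence of the numbers $\overline S(v,\alpha)$, $v\in V'$ (with multiplicity), arranged in nondecreasing order. A nondecreasing sequence of nonnegative integers is continuous if it contains every integer between its smallest and largest element. The composition (lexicographic product) $G[H]$ has vertex set $V(G)\times V(H)$, with $(u_1,v_1)(u_2,v_2)$ an edge iff $u_1u_2\in E(G)$, or $u_1=u_2$ and $v_1v_2\in E(H)$. -}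

module Defs where

open import Data.Nat using (ℕ; zero; suc; _+_; _*_; _≤_; _⊔_)
open import Data.Bool using (Bool; true; false; _∧_; _∨_; if_then_else_)
open import Data.Bool.Properties using (∨-comm)
open import Data.Fin using (Fin; remQuot; _≟_)
open import Data.List using (List; map; foldr; allFin)
open import Data.List.Membership.Propositional using (_∈_)
open import Data.Product using (Σ; ∃; ∃-syntax; _×_; _,_; proj₁; proj₂)
open import Relation.Nullary using (does; yes; no)
open import Relation.Binary.PropositionalEquality using (_≡_; refl; sym; cong; cong₂)

record Graph : Set where
  field
    size   : ℕ
    adj    : Fin size → Fin size → Bool
    adj-sym   : ∀ u v → adj u v ≡ adj v u
    adj-irrefl : ∀ u → adj u u ≡ false
open Graph public

eqF : ∀ {n} → Fin n → Fin n → Bool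
eqF u v = does (u ≟ v)

eqF-sym : ∀ {n} (u v : Fin n) → eqF u v ≡ eqF v u
eqF-sym u v with u ≟ v | v ≟ u
... | yes _ | yes _ = refl
... | no _  | no _  = refl
... | yes p | no q  with q (sym p)
...   | ()
eqF-sym u v | no q | yes p with q (sym p)
...   | ()

eqF-refl : ∀ {n} (u : Fin n) → eqF u u ≡ true
eqF-refl u with u ≟ u
... | yes _ = refl
... | no q with q refl
...   | ()

-- Composition (lexicographic product) G[H]; vertex (u , v) of
-- V(G) × V(H) is encoded as an element of Fin (|V(G)| * |V(H)|)
-- via Data.Fin.remQuot / combine.

compAdjPair : (G H : Graph) → Fin (size G) × Fin (size H) → Fin (size G) × Fin (size H) → Bool
compAdjPair G H (u₁ , v₁) (u₂ , v₂) = adj G u₁ u₂ ∨ (eqF u₁ u₂ ∧ adj H v₁ v₂)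

compAdjPair-sym : (G H : Graph) → ∀ p q → compAdjPair G H p q ≡ compAdjPair G H q p
compAdjPair-sym G H (u₁ , v₁) (u₂ , v₂) =
  cong₂ _∨_ (adj-sym G u₁ u₂) (cong₂ _∧_ (eqF-sym u₁ u₂) (adj-sym H v₁ v₂))

compAdjPair-irrefl : (G H : Graph) → ∀ p → compAdjPair G H p p ≡ false
compAdjPair-irrefl G H (u , v) rewrite adj-irrefl G u | eqF-refl u | adj-irrefl H v = refl

compose : Graph → Graph → Graph
compose G H = record
  { size = size G * size H
  ; adj = λ x y → compAdjPair G H (remQuot (size H) x) (remQuot (size H) y)
  ; adj-sym = λ x y → compAdjPair-sym G H (remQuot (size H) x) (remQuot (size H) y)
  ; adj-irrefl = λ x → compAdjPair-irrefl G H (remQuot (size H) x)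
  }

-- an edge-coloring assigns a color to each ordered pair; only the values
-- on edges matter, and they are required to be symmetric.
EdgeColoring : Graph → Set
EdgeColoring G = Fin (size G) → Fin (size G) → ℕ

InSpectrum : (G : Graph) → EdgeColoring G → Fin (size G) → ℕ → Set
InSpectrum G α v k = ∃[ u ] (adj G v u ≡ true × α v u ≡ k)

record IsIntervalColoring (G : Graph) (t : ℕ) (α : EdgeColoring G) : Set where
  field
    symmetric : ∀ u v → adj G u v ≡ true → α u v ≡ α v u
    inRange   : ∀ u v → adj G u v ≡ true → 1 ≤ α u v × α u v ≤ t
    allUsed   : ∀ k → 1 ≤ k → k ≤ t → ∃[ u ] ∃[ v ] (adj G u v ≡ true × α u v ≡ k)
    proper    : ∀ u v w → adj G u v ≡ true → adj G u w ≡ true → α u v ≡ α u w → v ≡ w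
    interval  : ∀ v a b k → InSpectrum G α v a → InSpectrum G α v b →
                a ≤ k → k ≤ b → InSpectrum G α v k

HasIntervalColoring : Graph → ℕ → Set
HasIntervalColoring G t = Σ (EdgeColoring G) (IsIntervalColoring G t)

IntervalColorable : Graph → Set
IntervalColorable G = ∃[ t ] (1 ≤ t × HasIntervalColoring G t)

IsW-min : Graph → ℕ → Set
IsW-min G t = 1 ≤ t × HasIntervalColoring G t ×
              (∀ t' → 1 ≤ t' → HasIntervalColoring G t' → t ≤ t')

IsW-max : Graph → ℕ → Set
IsW-max G t = 1 ≤ t × HasIntervalColoring G t ×
              (∀ t' → 1 ≤ t' → HasIntervalColoring G t' → t' ≤ t)

maxList : List ℕ → ℕ
maxList = foldr _⊔_ 0

-- \overline S(v, α) = max S(v, α)  (0 if v is isolated)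
maxSpec : (G : Graph) → EdgeColoring G → Fin (size G) → ℕ
maxSpec G α v = maxList (map (λ u → if adj G v u then α v u else 0) (allFin (size G)))

-- the multiset USE(V(G), α) as a list (order irrelevant for what follows)
USE : (G : Graph) → EdgeColoring G → List ℕ
USE G α = map (maxSpec G α) (allFin (size G))

Continuous : List ℕ → Set
Continuous xs = ∀ k → (∃[ a ] (a ∈ xs × a ≤ k)) → (∃[ b ] (b ∈ xs × k ≤ b)) → k ∈ xs

module Submission where

-- An edge inside the copy of H at u keeps its colour αH shifted by
-- (min S(u, αG) - 1)·n.  An edge (u, v)(u', w) over an edge uu' of colour c gets
-- (c - 1)·n + ψ(v, w), where ψ is an n × n "window array": row v and column v
-- of ψ both list the n integers above maxSpec(v) = max S(v, αH) exactly once.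
-- Continuity of USE makes the sorted maxSpec values increase by steps 0 or 1,
-- and for such a staircase a cyclically shifted array is a window array.
--
-- The
-- theorem follows by applying the construction to a w(G)- and a W(G)-colouring.

open import Defs
open import Data.Nat using (ℕ; zero; suc; _+_; _*_; _∸_; _≤_; _<_; _⊔_; z≤n; s≤s; _≤?_; _<ᵇ_; NonZero; >-nonZero)
open import Data.Nat.Properties
open import Data.Nat.DivMod using (_/_; _%_; m≡m%n+[m/n]*n; m%n<n)
open import Data.Nat.Tactic.RingSolver using (solve-∀; solve)
open import Data.Fin using (Fin; zero; suc; toℕ; fromℕ<; punchIn; punchOut; remQuot; combine)
open import Data.Fin.Properties
  using (toℕ-injective; toℕ-fromℕ<; toℕ<n; punchOut-injective; injective⇒≤; any?;
         punchIn-punchOut; remQuot-combine; combine-remQuot)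
  renaming (_≟_ to _≟F_)
open import Data.Bool using (Bool; true; false; if_then_else_; not; T)
open import Data.List using (List; []; _∷_; map; allFin)
open import Data.List.Extrema.Nat using (min; min≤⊤; min≤xs; argmin-sel)
open import Data.List.Membership.Propositional using (_∈_)
open import Data.List.Membership.Propositional.Properties using (∈-map⁺; ∈-map⁻; ∈-allFin; foldr-selective)
open import Data.List.Relation.Unary.All as All using ()
open import Data.List.Relation.Unary.Any using (here; there)
open import Data.Product using (Σ; ∃; ∃-syntax; _×_; _,_; proj₁; proj₂; uncurry)
open import Data.Sum using (_⊎_; inj₁; inj₂)
open import Data.Empty using (⊥; ⊥-elim)
open import Data.Unit using (tt)
open import Function using (_∘_; id; case_of_)
open import Relation.Nullary using (¬_; yes; no)
open import Relation.Binary.Definitions using (tri<; tri≈; tri>)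
open import Relation.Binary.PropositionalEquality

≤-maxList : ∀ {x} (xs : List ℕ) → x ∈ xs → x ≤ maxList xs
≤-maxList (y ∷ ys) (here refl) = m≤m⊔n y _
≤-maxList (y ∷ ys) (there x∈ys) = ≤-trans (≤-maxList ys x∈ys) (m≤n⊔m y _)

maxList-lub : ∀ (xs : List ℕ) {b} → (∀ {x} → x ∈ xs → x ≤ b) → maxList xs ≤ b
maxList-lub [] ub = z≤n
maxList-lub (y ∷ ys) ub = ⊔-lub (ub (here refl)) (maxList-lub ys (ub ∘ there))

maxList-sel : ∀ (xs : List ℕ) → maxList xs ≡ 0 ⊎ maxList xs ∈ xs
maxList-sel = foldr-selective ⊔-sel 0

min≤member : ∀ {x} ⊤ (xs : List ℕ) → x ∈ xs → min ⊤ xs ≤ x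
min≤member ⊤ xs = All.lookup (min≤xs ⊤ xs)

-- an injective endomap of Fin n is surjective (else punching out the
-- missed value would inject Fin n into Fin (n - 1))
injective⇒surjective : ∀ {n} (f : Fin n → Fin n) → (∀ x y → f x ≡ f y → x ≡ y) →
                       ∀ y → ∃ λ x → f x ≡ y
injective⇒surjective {zero} f inj ()
injective⇒surjective {suc m} f inj y with any? (λ x → f x ≟F y)
... | yes hit = hit
... | no miss = ⊥-elim (<-irrefl refl (injective⇒≤ {f = squeeze} squeeze-injective))
  where
  y≢f : ∀ x → y ≢ f x
  y≢f x y≡fx = miss (x , sym y≡fx)
  squeeze : Fin (suc m) → Fin m
  squeeze x = punchOut (y≢f x)
  squeeze-injective : ∀ {x z} → squeeze x ≡ squeeze z → x ≡ z
  squeeze-injective {x} {z} eq = inj x z (punchOut-injective (y≢f x) (y≢f z) eq)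

injective-fills-window : ∀ {n} (f : Fin n → ℕ) (lo : ℕ) →
  (∀ x → lo < f x) → (∀ x → f x ≤ lo + n) → (∀ x y → f x ≡ f y → x ≡ y) →
  ∀ k → lo < k → k ≤ lo + n → ∃ λ x → f x ≡ k
injective-fills-window {n} f lo lo<f f≤hi inj k lo<k k≤hi =
  x , offset-injective (lo<f x) (f≤hi x) lo<k k≤hi (cong toℕ gx≡k)
  where
  offset< : ∀ {m} → lo < m → m ≤ lo + n → m ∸ suc lo < n
  offset< {m} lo<m m≤hi = begin-strict
      m ∸ suc lo  <⟨ ∸-monoˡ-< (s≤s m≤hi) lo<m ⟩
      lo + n ∸ lo ≡⟨ m+n∸m≡n lo n ⟩
      n           ∎
    where open ≤-Reasoning
  offset : ∀ {m} → lo < m → m ≤ lo + n → Fin n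
  offset lo<m m≤hi = fromℕ< (offset< lo<m m≤hi)
  offset-injective : ∀ {m m'} (p : lo < m) (q : m ≤ lo + n) (p' : lo < m') (q' : m' ≤ lo + n) →
                     toℕ (offset p q) ≡ toℕ (offset p' q') → m ≡ m'
  offset-injective {m} {m'} p q p' q' eq = begin
      m                 ≡⟨ m∸n+n≡m p ⟨
      m ∸ suc lo + suc lo ≡⟨ cong (_+ suc lo) (trans (sym (toℕ-fromℕ< _)) (trans eq (toℕ-fromℕ< _))) ⟩
      m' ∸ suc lo + suc lo ≡⟨ m∸n+n≡m p' ⟩
      m'                ∎
    where open ≡-Reasoning
  g : Fin n → Fin n
  g x = offset (lo<f x) (f≤hi x)
  hit : ∃ λ x → g x ≡ offset lo<k k≤hi
  hit = injective⇒surjective g (λ x y gx≡gy → inj x y (offset-injective (lo<f x) (f≤hi x) (lo<f y) (f≤hi y) (cong toℕ gx≡gy)))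
          (offset lo<k k≤hi)
  x = proj₁ hit
  gx≡k = proj₂ hit

argminFin : ∀ {n} (d : Fin (suc n) → ℕ) → Σ (Fin (suc n)) (λ a → ∀ x → d a ≤ d x)
argminFin {zero} d = zero , λ { zero → ≤-refl }
argminFin {suc n} d with argminFin (λ x → d (suc x))
... | a , a-min with d zero ≤? d (suc a)
...   | yes d0≤ = zero , λ { zero → ≤-refl ; (suc x) → ≤-trans d0≤ (a-min x) }
...   | no d0≰ = suc a , λ { zero → <⇒≤ (≰⇒> d0≰) ; (suc x) → a-min x }

record Sorting (n : ℕ) (d : Fin n → ℕ) : Set where
  field
    byRank rank : Fin n → Fin n
    byRank-rank : ∀ x → byRank (rank x) ≡ x
    sorted      : ∀ i j → toℕ i ≤ toℕ j → d (byRank i) ≤ d (byRank j)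

sortBy : ∀ n (d : Fin n → ℕ) → Sorting n d
sortBy zero d = record { byRank = λ () ; rank = λ () ; byRank-rank = λ () ; sorted = λ () }
sortBy (suc n) d = record
  { byRank = byRank ; rank = rank ; byRank-rank = byRank-rank ; sorted = sorted }
  where
  a = proj₁ (argminFin d)
  module Rest = Sorting (sortBy n (λ x → d (punchIn a x)))
  byRank : Fin (suc n) → Fin (suc n)
  byRank zero = a
  byRank (suc i) = punchIn a (Rest.byRank i)
  rank : Fin (suc n) → Fin (suc n)
  rank x with a ≟F x
  ... | yes _ = zero
  ... | no a≢x = suc (Rest.rank (punchOut a≢x))
  byRank-rank : ∀ x → byRank (rank x) ≡ x
  byRank-rank x with a ≟F x
  ... | yes a≡x = a≡x
  ... | no a≢x = trans (cong (punchIn a) (Rest.byRank-rank (punchOut a≢x))) (punchIn-punchOut a≢x)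
  sorted : ∀ i j → toℕ i ≤ toℕ j → d (byRank i) ≤ d (byRank j)
  sorted zero j _ = proj₂ (argminFin d) (byRank j)
  sorted (suc i) (suc j) (s≤s i≤j) = Rest.sorted i j i≤j

next-block : ∀ c a n → c * n + (a + n) ≡ suc c * n + a
next-block = solve-∀

regroup : ∀ a j m → suc (a + (j + m)) ≡ a + m + suc j
regroup = solve-∀

reorder : ∀ a i j → suc (a + i + j) ≡ a + j + suc i
reorder = solve-∀

reorder₁ : ∀ a j i → suc (a + j) + i ≡ suc (a + i + j)
reorder₁ = solve-∀

reorder₂ : ∀ a m j → suc (a + m + j) ≡ a + (j + suc m)
reorder₂ = solve-∀

block-shift : ∀ m q n a → (m + q) * n + a ≡ q * n + (m * n + a)
block-shift = solve-∀

block-entry : ∀ m q n a r → (m + q) * n + suc (a + r) ≡ q * n + suc (m * n + a + r)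
block-entry = solve-∀

suc-∸1 : ∀ {c} → 1 ≤ c → suc (c ∸ 1) ≡ c
suc-∸1 (s≤s _) = refl

split-blocks : ∀ n .{{_ : NonZero n}} lo k → lo < k → ∃ λ q → ∃ λ r → r < n × q * n + suc (lo + r) ≡ k
split-blocks n lo k lo<k = x / n , x % n , m%n<n x n , (begin
    x / n * n + suc (lo + x % n) ≡⟨ rearrange (x / n * n) lo (x % n) ⟩
    (x % n + x / n * n) + suc lo ≡⟨ cong (_+ suc lo) (m≡m%n+[m/n]*n x n) ⟨
    x + suc lo                   ≡⟨ m∸n+n≡m lo<k ⟩
    k                            ∎)
  where
  open ≡-Reasoning
  x = k ∸ suc lo
  rearrange : ∀ a l r → a + suc (l + r) ≡ (r + a) + suc l
  rearrange = solve-∀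

below-top : ∀ a {j n} → j < n → suc (a + j) ≤ a + n
below-top a {j} j<n = ≤-trans (≤-reflexive (sym (+-suc a j))) (+-monoʳ-≤ a j<n)

block-below : ∀ n lo {a b x y} → a < b → x ≤ lo + n → lo < y → a * n + x < b * n + y
block-below n lo {a} {b} {x} {y} a<b x≤ lo<y = begin-strict
    a * n + x        ≤⟨ +-monoʳ-≤ (a * n) x≤ ⟩
    a * n + (lo + n) ≡⟨ next-block a lo n ⟩
    suc a * n + lo   ≤⟨ +-monoˡ-≤ lo (*-monoˡ-≤ n a<b) ⟩
    b * n + lo       <⟨ +-monoʳ-< (b * n) lo<y ⟩
    b * n + y        ∎
  where open ≤-Reasoning

block-injective : ∀ n lo {a b x y} → a * n + x ≡ b * n + y →
                  lo < x → x ≤ lo + n → lo < y → y ≤ lo + n → a ≡ b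
block-injective n lo {a} {b} eq lo<x x≤ lo<y y≤ with <-cmp a b
... | tri< a<b _ _ = ⊥-elim (<-irrefl eq (block-below n lo a<b x≤ lo<y))
... | tri≈ _ a≡b _ = a≡b
... | tri> _ _ b<a = ⊥-elim (<-irrefl (sym eq) (block-below n lo b<a y≤ lo<x))

cross-balance : ∀ v i₁ i₂ x₁ x₂ y → v + i₁ ≡ suc (x₁ + y) → v + i₂ ≡ suc (x₂ + y) → x₁ + i₂ ≡ x₂ + i₁
cross-balance v i₁ i₂ x₁ x₂ y eq₁ eq₂ = +-cancelʳ-≡ (suc y) _ _ (begin
    x₁ + i₂ + suc y   ≡⟨ solve (x₁ ∷ i₂ ∷ y ∷ []) ⟩
    suc (x₁ + y) + i₂ ≡⟨ cong (_+ i₂) eq₁ ⟨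
    v + i₁ + i₂       ≡⟨ solve (v ∷ i₁ ∷ i₂ ∷ []) ⟩
    v + i₂ + i₁       ≡⟨ cong (_+ i₁) eq₂ ⟩
    suc (x₂ + y) + i₁ ≡⟨ solve (x₂ ∷ i₁ ∷ y ∷ []) ⟩
    x₂ + i₁ + suc y   ∎)
  where open ≡-Reasoning

-- Let  D 0 ≤ D 1 ≤ … ≤ D n'  increase by steps of 0 or 1, and n = n' + 1.
-- Row i of the array lists the window (D i, D i + n] in some order: a
-- row that starts a new value of D ("leading" row) lists it in order,
--      entry i j = D i + 1 + j,
-- a row repeating the value of its predecessor is rotated by i,
--      entry i j = D i + 1 + ((j - i) mod n).
-- Then every column j also lists its own window (D j, D j + n] exactly
-- once: in column j the entries of the three kinds of rows occupy three
-- disjoint bands, and inside each band distinct rows give distinct values.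

module Staircase (n' : ℕ) (D : ℕ → ℕ)
                 (D-step≥0 : ∀ i → D i ≤ D (suc i)) (D-step≤1 : ∀ i → D (suc i) ≤ suc (D i)) where

  n : ℕ
  n = suc n'

  D-monotone : ∀ {i j} → i ≤ j → D i ≤ D j
  D-monotone {i} {j} i≤j with m≤n⇒∃[o]m+o≡n i≤j
  ... | x , refl = climb x
    where
    climb : ∀ x → D i ≤ D (i + x)
    climb zero = ≤-reflexive (cong D (sym (+-identityʳ i)))
    climb (suc x) = ≤-trans (climb x) (≤-trans (D-step≥0 (i + x)) (≤-reflexive (cong D (sym (+-suc i x)))))

  D-lipschitz : ∀ {i j} → i ≤ j → D j + i ≤ D i + j
  D-lipschitz {i} {j} i≤j with m≤n⇒∃[o]m+o≡n i≤j
  ... | x , refl = begin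
      D (i + x) + i ≤⟨ +-monoˡ-≤ i (climb x) ⟩
      D i + x + i   ≡⟨ trans (+-assoc (D i) x i) (cong (D i +_) (+-comm x i)) ⟩
      D i + (i + x) ∎
    where
    open ≤-Reasoning
    climb : ∀ x → D (i + x) ≤ D i + x
    climb zero = ≤-reflexive (trans (cong D (+-identityʳ i)) (sym (+-identityʳ (D i))))
    climb (suc x) = begin
      D (i + suc x)   ≡⟨ cong D (+-suc i x) ⟩
      D (suc (i + x)) ≤⟨ D-step≤1 (i + x) ⟩
      suc (D (i + x)) ≤⟨ s≤s (climb x) ⟩
      suc (D i + x)   ≡⟨ +-suc (D i) x ⟨
      D i + suc x     ∎

  D≤D0+ : ∀ j → D j ≤ D 0 + j
  D≤D0+ j = ≤-trans (m≤m+n (D j) 0) (D-lipschitz {0} {j} z≤n)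

  Leading Repeated : ℕ → Set
  Leading i = i ≡ 0 ⊎ ∃ λ i' → i ≡ suc i' × D i ≡ suc (D i')
  Repeated i = ∃ λ i' → i ≡ suc i' × D i ≡ D i'

  leading-not-repeated : ∀ {i} → Leading i → Repeated i → ⊥
  leading-not-repeated (inj₁ refl) (_ , () , _)
  leading-not-repeated (inj₂ (i' , refl , rise)) (.i' , refl , same) = 1+n≢n (trans (sym rise) same)

  leading-or-repeated : ∀ i → Leading i ⊎ Repeated i
  leading-or-repeated zero = inj₁ (inj₁ refl)
  leading-or-repeated (suc i) with D (suc i) ≟ D i
  ... | yes same = inj₂ (i , refl , same)
  ... | no differ = inj₁ (inj₂ (i , refl , ≤-antisym (D-step≤1 i) (≤∧≢⇒< (D-step≥0 i) (differ ∘ sym))))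

  -- the entry in row i, column j (meaningful for i, j < n)
  entry : ℕ → ℕ → ℕ
  entry i j with leading-or-repeated i | i ≤? j
  ... | inj₁ _ | _     = suc (D i + j)
  ... | inj₂ _ | yes _ = suc (D i + (j ∸ i))
  ... | inj₂ _ | no _  = suc (D i + (j + n ∸ i))

  -- the three shapes of an entry, with the rotation written additively
  data Entry (i j v : ℕ) : Set where
    leading : Leading i → v ≡ suc (D i + j) → Entry i j v
    shifted : Repeated i → i ≤ j → v + i ≡ suc (D i + j) → Entry i j v
    wrapped : Repeated i → j < i → v + i ≡ suc (D i + (j + n)) → Entry i j v

  unrotate : ∀ {i y} → i ≤ y → suc (D i + (y ∸ i)) + i ≡ suc (D i + y)
  unrotate {i} {y} i≤y = cong suc (trans (+-assoc (D i) (y ∸ i) i) (cong (D i +_) (m∸n+n≡m i≤y)))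

  entry-shape : ∀ i j → i < n → Entry i j (entry i j)
  entry-shape i j i<n with leading-or-repeated i | i ≤? j
  ... | inj₁ lead | _       = leading lead refl
  ... | inj₂ rep  | yes i≤j = shifted rep i≤j (unrotate i≤j)
  ... | inj₂ rep  | no i≰j  = wrapped rep (≰⇒> i≰j) (unrotate (≤-trans (<⇒≤ i<n) (m≤n+m n j)))

  window-of-sum : ∀ {v i s lo hi} → v + i ≡ s → lo + i < s → s ≤ hi + i → lo < v × v ≤ hi
  window-of-sum {v} {i} {lo = lo} {hi} refl lo+i<s s≤hi+i =
    +-cancelʳ-< i lo v lo+i<s , +-cancelʳ-≤ i v hi s≤hi+i

  row-window : ∀ {i j v} → i < n → j < n → Entry i j v → D i < v × v ≤ D i + n
  row-window {i} {j} i<n j<n (leading _ refl) = s≤s (m≤m+n (D i) j) , below-top (D i) j<n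
  row-window {i} {j} i<n j<n (shifted _ i≤j eq) =
    window-of-sum eq (s≤s (+-monoʳ-≤ (D i) i≤j)) (≤-trans (below-top (D i) j<n) (m≤m+n _ i))
  row-window {i} {j} i<n j<n (wrapped _ j<i eq) =
    window-of-sum eq (s≤s (+-monoʳ-≤ (D i) (≤-trans (<⇒≤ i<n) (m≤n+m n j))))
      (≤-trans (≤-reflexive (regroup (D i) j n)) (+-monoʳ-≤ (D i + n) j<i))

  column-window : ∀ {i j v} → i < n → j < n → Entry i j v → D j < v × v ≤ D j + n
  column-window {i} {j} i<n j<n (leading _ refl) =
    s≤s (≤-trans (D≤D0+ j) (+-monoˡ-≤ j (D-monotone z≤n))) ,
    (begin
      suc (D i + j)  ≤⟨ s≤s (+-monoˡ-≤ j (D-monotone (≤-pred i<n))) ⟩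
      suc (D n' + j) ≤⟨ s≤s (D-lipschitz (≤-pred j<n)) ⟩
      suc (D j + n') ≡⟨ +-suc (D j) n' ⟨
      D j + n        ∎)
    where open ≤-Reasoning
  column-window {i} {j} i<n j<n (shifted _ i≤j eq) =
    window-of-sum eq (s≤s (D-lipschitz i≤j))
      (≤-trans (≤-trans (≤-reflexive (sym (+-suc (D i) j))) (+-mono-≤ (D-monotone i≤j) j<n)) (m≤m+n _ i))
  column-window {.(suc i')} {j} i<n j<n (wrapped (i' , refl , same) j<i eq) =
    window-of-sum eq
      (s≤s (+-mono-≤ (D-monotone (<⇒≤ j<i)) (≤-trans (<⇒≤ i<n) (m≤n+m n j))))
      (begin
        suc (D (suc i') + (j + n)) ≡⟨ cong (λ a → suc (a + (j + n))) same ⟩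
        suc (D i' + (j + n))       ≡⟨ cong suc (+-assoc (D i') j n) ⟨
        suc (D i' + j + n)         ≤⟨ s≤s (+-monoˡ-≤ n (D-lipschitz (≤-pred j<i))) ⟩
        suc (D j + i' + n)         ≡⟨ cong suc (+-assoc (D j) i' n) ⟩
        suc (D j + (i' + n))       ≡⟨ regroup (D j) i' n ⟩
        D j + n + suc i'           ∎)
    where open ≤-Reasoning

  not-wrapped-index : ∀ {j j'} → j < n → j ≢ j' + n
  not-wrapped-index {j} {j'} j<n refl = <⇒≱ j<n (m≤n+m n j')

  row-injective : ∀ {i j j' v} → j < n → j' < n → Entry i j v → Entry i j' v → j ≡ j'
  row-injective {i} _ _ (leading _ refl) (leading _ eq) = +-cancelˡ-≡ (D i) _ _ (suc-injective eq)
  row-injective _ _ (leading lead _) (shifted rep _ _) = ⊥-elim (leading-not-repeated lead rep)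
  row-injective _ _ (leading lead _) (wrapped rep _ _) = ⊥-elim (leading-not-repeated lead rep)
  row-injective _ _ (shifted rep _ _) (leading lead _) = ⊥-elim (leading-not-repeated lead rep)
  row-injective _ _ (wrapped rep _ _) (leading lead _) = ⊥-elim (leading-not-repeated lead rep)
  row-injective {i} _ _ (shifted _ _ eq) (shifted _ _ eq') =
    +-cancelˡ-≡ (D i) _ _ (suc-injective (trans (sym eq) eq'))
  row-injective {i} _ _ (wrapped _ _ eq) (wrapped _ _ eq') =
    +-cancelʳ-≡ n _ _ (+-cancelˡ-≡ (D i) _ _ (suc-injective (trans (sym eq) eq')))
  row-injective {i} j<n _ (shifted _ _ eq) (wrapped _ _ eq') =
    ⊥-elim (not-wrapped-index j<n (+-cancelˡ-≡ (D i) _ _ (suc-injective (trans (sym eq) eq'))))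
  row-injective {i} _ j'<n (wrapped _ _ eq) (shifted _ _ eq') =
    ⊥-elim (not-wrapped-index j'<n (+-cancelˡ-≡ (D i) _ _ (suc-injective (trans (sym eq') eq))))

  shifted-band : ∀ {i j v} → Repeated i → v + i ≡ suc (D i + j) → v ≤ D 0 + j
  shifted-band {.(suc i')} {j} {v} (i' , refl , same) eq = +-cancelʳ-≤ (suc i') v (D 0 + j) (begin
      v + suc i'           ≡⟨ eq ⟩
      suc (D (suc i') + j) ≡⟨ cong (λ a → suc (a + j)) same ⟩
      suc (D i' + j)       ≤⟨ s≤s (+-monoˡ-≤ j (D≤D0+ i')) ⟩
      suc (D 0 + i' + j)   ≡⟨ reorder (D 0) i' j ⟩
      D 0 + j + suc i'     ∎)
    where open ≤-Reasoning

  leading-band : ∀ {i j v} → i < n → v ≡ suc (D i + j) → D 0 + j < v × v ≤ suc (D n' + j)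
  leading-band {i} {j} i<n refl =
    s≤s (+-monoˡ-≤ j (D-monotone z≤n)) , s≤s (+-monoˡ-≤ j (D-monotone (≤-pred i<n)))

  wrapped-band : ∀ {i j v} → i < n → v + i ≡ suc (D i + (j + n)) → suc (D n' + j) < v
  wrapped-band {i} {j} {v} i<n eq = +-cancelʳ-≤ i _ v (begin
      suc (suc (D n' + j)) + i ≡⟨ cong suc (reorder₁ (D n') j i) ⟩
      suc (suc (D n' + i + j)) ≤⟨ s≤s (s≤s (+-monoˡ-≤ j (D-lipschitz (≤-pred i<n)))) ⟩
      suc (suc (D i + n' + j)) ≡⟨ cong suc (reorder₂ (D i) n' j) ⟩
      suc (D i + (j + n))      ≡⟨ eq ⟨
      v + i                    ∎)
    where open ≤-Reasoning

  low≤high : ∀ {j} → D 0 + j ≤ suc (D n' + j)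
  low≤high {j} = ≤-trans (+-monoˡ-≤ j (D-monotone z≤n)) (n≤1+n _)

  leading-rises : ∀ {i₁ i₂} → i₁ < i₂ → Leading i₂ → D i₁ < D i₂
  leading-rises () (inj₁ refl)
  leading-rises {i₁} i₁<i₂ (inj₂ (i' , refl , rise)) =
    ≤-trans (s≤s (D-monotone (≤-pred i₁<i₂))) (≤-reflexive (sym rise))

  repeated-lags : ∀ {i₁ i₂} → i₁ < i₂ → Repeated i₂ → D i₂ + i₁ < D i₁ + i₂
  repeated-lags {i₁} i₁<i₂ (i' , refl , same) = begin-strict
      D (suc i') + i₁ ≡⟨ cong (_+ i₁) same ⟩
      D i' + i₁       ≤⟨ D-lipschitz (≤-pred i₁<i₂) ⟩
      D i₁ + i'       <⟨ +-monoʳ-< (D i₁) ≤-refl ⟩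
      D i₁ + suc i'   ∎
    where open ≤-Reasoning

  only-diagonal : {R : ℕ → ℕ → Set} → (∀ {a b} → R a b → R b a) → (∀ {a b} → a < b → R a b → ⊥) →
                  ∀ {a b} → R a b → a ≡ b
  only-diagonal {R} sym-R off-diagonal {a} {b} r with <-cmp a b
  ... | tri< a<b _ _ = ⊥-elim (off-diagonal a<b r)
  ... | tri≈ _ a≡b _ = a≡b
  ... | tri> _ _ b<a = ⊥-elim (off-diagonal b<a (sym-R r))

  repeated-injective : ∀ {i₁ i₂ v y} → Repeated i₁ → Repeated i₂ →
                       v + i₁ ≡ suc (D i₁ + y) → v + i₂ ≡ suc (D i₂ + y) → i₁ ≡ i₂
  repeated-injective {i₁} {i₂} {v} {y} rep₁ rep₂ eq₁ eq₂ =
    only-diagonal {Balanced} (λ (r , r' , e) → r' , r , sym e)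
      (λ a<b (_ , rep-b , e) → <-irrefl (sym e) (repeated-lags a<b rep-b))
      (rep₁ , rep₂ , cross-balance v i₁ i₂ (D i₁) (D i₂) y eq₁ eq₂)
    where
    Balanced : ℕ → ℕ → Set
    Balanced a b = Repeated a × Repeated b × D a + b ≡ D b + a

  leading-injective : ∀ {i₁ i₂} → Leading i₁ → Leading i₂ → D i₁ ≡ D i₂ → i₁ ≡ i₂
  leading-injective lead₁ lead₂ same =
    only-diagonal {Level} (λ (l , l' , e) → l' , l , sym e)
      (λ a<b (_ , lead-b , e) → <-irrefl e (leading-rises a<b lead-b))
      (lead₁ , lead₂ , same)
    where
    Level : ℕ → ℕ → Set
    Level a b = Leading a × Leading b × D a ≡ D b

  column-injective : ∀ {i₁ i₂ j v} → i₁ < n → i₂ < n → Entry i₁ j v → Entry i₂ j v → i₁ ≡ i₂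
  column-injective {j = j} _ _ (leading lead₁ eq₁) (leading lead₂ eq₂) =
    leading-injective lead₁ lead₂ (+-cancelʳ-≡ j _ _ (suc-injective (trans (sym eq₁) eq₂)))
  column-injective _ _ (shifted rep₁ _ eq₁) (shifted rep₂ _ eq₂) = repeated-injective rep₁ rep₂ eq₁ eq₂
  column-injective _ _ (wrapped rep₁ _ eq₁) (wrapped rep₂ _ eq₂) = repeated-injective rep₁ rep₂ eq₁ eq₂
  column-injective i₁<n _ (leading _ eq) (shifted rep _ eq') =
    ⊥-elim (<⇒≱ (proj₁ (leading-band i₁<n eq)) (shifted-band rep eq'))
  column-injective _ i₂<n (shifted rep _ eq) (leading _ eq') =
    ⊥-elim (<⇒≱ (proj₁ (leading-band i₂<n eq')) (shifted-band rep eq))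
  column-injective i₁<n i₂<n (leading _ eq) (wrapped _ _ eq') =
    ⊥-elim (<⇒≱ (wrapped-band i₂<n eq') (proj₂ (leading-band i₁<n eq)))
  column-injective i₁<n i₂<n (wrapped _ _ eq) (leading _ eq') =
    ⊥-elim (<⇒≱ (wrapped-band i₁<n eq) (proj₂ (leading-band i₂<n eq')))
  column-injective _ i₂<n (shifted rep _ eq) (wrapped _ _ eq') =
    ⊥-elim (<⇒≱ (wrapped-band i₂<n eq') (≤-trans (shifted-band rep eq) low≤high))
  column-injective i₁<n _ (wrapped _ _ eq) (shifted rep _ eq') =
    ⊥-elim (<⇒≱ (wrapped-band i₁<n eq) (≤-trans (shifted-band rep eq') low≤high))

Contiguous : ∀ {n} → (Fin n → ℕ) → Set
Contiguous d = ∀ k → (∃ λ a → d a ≤ k) → (∃ λ b → k ≤ d b) → ∃ λ c → d c ≡ k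

record WindowArray (n : ℕ) (d : Fin n → ℕ) (ψ : Fin n → Fin n → ℕ) : Set where
  field
    row-window       : ∀ v w → d v < ψ v w × ψ v w ≤ d v + n
    row-injective    : ∀ v w w' → ψ v w ≡ ψ v w' → w ≡ w'
    column-window    : ∀ v w → d w < ψ v w × ψ v w ≤ d w + n
    column-injective : ∀ v v' w → ψ v w ≡ ψ v' w → v ≡ v'

-- sorted, a contiguous family increases by steps of 0 or 1, so the
-- staircase array, indexed by ranks, is a window array
windowArray : ∀ n (d : Fin n → ℕ) → Contiguous d → Σ (Fin n → Fin n → ℕ) (WindowArray n d)
windowArray zero d _ =
  (λ ()) , record { row-window = λ () ; row-injective = λ () ; column-window = λ () ; column-injective = λ () }
windowArray (suc n') d contiguous = ψ , record
  { row-window       = λ v w → at-rank v (row-window (rank< v) (rank< w) (shape v w))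
  ; row-injective    = λ v w w' eq → rank-injective (row-injective (rank< w) (rank< w')
                                       (shape v w) (subst (Entry _ _) (sym eq) (shape v w')))
  ; column-window    = λ v w → at-rank w (column-window (rank< v) (rank< w) (shape v w))
  ; column-injective = λ v v' w eq → rank-injective (column-injective (rank< v) (rank< v')
                                       (shape v w) (subst (Entry _ _) (sym eq) (shape v' w)))
  }
  where
  open Sorting (sortBy (suc n') d)
  -- the sorted values, extended constantly beyond the last index
  D : ℕ → ℕ
  D i = d (byRank (fromℕ< (s≤s (m⊓n≤n i n'))))
  D-sorted : ∀ {i j} → i ≤ j → D i ≤ D j
  D-sorted {i} {j} i≤j = sorted _ _ (subst₂ _≤_ (sym (toℕ-fromℕ< _)) (sym (toℕ-fromℕ< _)) (⊓-monoˡ-≤ n' i≤j))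
  D-rank : ∀ x → D (toℕ (rank x)) ≡ d x
  D-rank x = cong d (trans (cong byRank (toℕ-injective (trans (toℕ-fromℕ< _)
                              (m≤n⇒m⊓n≡m (≤-pred (toℕ<n (rank x))))))) (byRank-rank x))
  -- a jump by 2 or more would skip a value taken by d
  D-step≤1 : ∀ i → D (suc i) ≤ suc (D i)
  D-step≤1 i with D (suc i) ≤? suc (D i)
  ... | yes ok = ok
  ... | no jump with contiguous (suc (D i)) (_ , n≤1+n _) (_ , <⇒≤ (≰⇒> jump))
  ...   | c , dc≡ with toℕ (rank c) ≤? i
  ...     | yes r≤i = ⊥-elim (<-irrefl refl (≤-trans (≤-reflexive (sym (trans (D-rank c) dc≡))) (D-sorted r≤i)))
  ...     | no r≰i = ⊥-elim (jump (≤-trans (D-sorted (≰⇒> r≰i)) (≤-reflexive (trans (D-rank c) dc≡))))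
  open Staircase n' D (λ i → D-sorted (n≤1+n i)) D-step≤1
  rank< : ∀ x → toℕ (rank x) < suc n'
  rank< x = toℕ<n (rank x)
  ψ : Fin (suc n') → Fin (suc n') → ℕ
  ψ v w = entry (toℕ (rank v)) (toℕ (rank w))
  shape : ∀ v w → Entry (toℕ (rank v)) (toℕ (rank w)) (ψ v w)
  shape v w = entry-shape _ _ (rank< v)
  at-rank : ∀ x {y} → D (toℕ (rank x)) < y × y ≤ D (toℕ (rank x)) + suc n' → d x < y × y ≤ d x + suc n'
  at-rank x = subst (λ a → a < _ × _ ≤ a + suc n') (D-rank x)
  rank-injective : ∀ {x y} → toℕ (rank x) ≡ toℕ (rank y) → x ≡ y
  rank-injective {x} {y} eq = trans (sym (byRank-rank x)) (trans (cong byRank (toℕ-injective eq)) (byRank-rank y))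

-- reading the array along row v (b = true) or along column v (b = false);
-- both readings list the window of v
along : ∀ {n} → (Fin n → Fin n → ℕ) → Bool → Fin n → Fin n → ℕ
along ψ true  v w = ψ v w
along ψ false v w = ψ w v

module Along {n} {d : Fin n → ℕ} {ψ : Fin n → Fin n → ℕ} (A : WindowArray n d ψ) where
  open WindowArray A

  along-window : ∀ b v w → d v < along ψ b v w × along ψ b v w ≤ d v + n
  along-window true  v w = row-window v w
  along-window false v w = column-window w v

  along-injective : ∀ b v w w' → along ψ b v w ≡ along ψ b v w' → w ≡ w'
  along-injective true  v w w' = row-injective v w w'
  along-injective false v w w' = column-injective w w' v

  along-fills : ∀ b v k → d v < k → k ≤ d v + n → ∃ λ w → along ψ b v w ≡ k
  along-fills b v = injective-fills-window (along ψ b v) (d v)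
    (λ w → proj₁ (along-window b v w)) (λ w → proj₂ (along-window b v w)) (along-injective b v)

module Spectrum (G : Graph) {t : ℕ} {α : EdgeColoring G} (I : IsIntervalColoring G t α) where
  open IsIntervalColoring I

  colourOr : ℕ → Fin (size G) → Fin (size G) → ℕ
  colourOr z v w = if adj G v w then α v w else z

  colourOr-edge : ∀ z {v w} → adj G v w ≡ true → colourOr z v w ≡ α v w
  colourOr-edge z vw rewrite vw = refl

  colours : ℕ → Fin (size G) → List ℕ
  colours z v = map (colourOr z v) (allFin (size G))

  colour∈colours : ∀ z {v w} → adj G v w ≡ true → α v w ∈ colours z v
  colour∈colours z {v} {w} vw = subst (_∈ colours z v) (colourOr-edge z vw) (∈-map⁺ (colourOr z v) (∈-allFin w))

  colours-member : ∀ z {v x} → x ∈ colours z v → x ≡ z ⊎ ∃ λ w → adj G v w ≡ true × α v w ≡ x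
  colours-member z {v} x∈ with ∈-map⁻ (colourOr z v) x∈
  ... | w , _ , refl with adj G v w in vw
  ...   | true  = inj₂ (w , vw , refl)
  ...   | false = inj₁ refl

  -- the least colour at v (t if v is isolated)
  minSpec : Fin (size G) → ℕ
  minSpec v = min t (colours t v)

  ≤-maxSpec : ∀ {v w} → adj G v w ≡ true → α v w ≤ maxSpec G α v
  ≤-maxSpec vw = ≤-maxList _ (colour∈colours 0 vw)

  maxSpec≤t : ∀ v → maxSpec G α v ≤ t
  maxSpec≤t v = maxList-lub (colours 0 v) λ x∈ → bounded (colours-member 0 x∈)
    where
    bounded : ∀ {x} → x ≡ 0 ⊎ (∃ λ w → adj G v w ≡ true × α v w ≡ x) → x ≤ t
    bounded (inj₁ refl) = z≤n
    bounded (inj₂ (w , vw , refl)) = proj₂ (inRange v w vw)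

  maxSpec-positive : ∀ {v w} → adj G v w ≡ true → maxSpec G α v ≢ 0
  maxSpec-positive {v} {w} vw max≡0 = <⇒≱ (proj₁ (inRange v w vw)) (subst (α v w ≤_) max≡0 (≤-maxSpec vw))

  maxSpec-attained : ∀ {v w} → adj G v w ≡ true → ∃ λ w' → adj G v w' ≡ true × α v w' ≡ maxSpec G α v
  maxSpec-attained {v} vw with maxList-sel (colours 0 v)
  ... | inj₁ max≡0 = ⊥-elim (maxSpec-positive vw max≡0)
  ... | inj₂ max∈ with colours-member 0 max∈
  ...   | inj₁ max≡0 = ⊥-elim (maxSpec-positive vw max≡0)
  ...   | inj₂ edge = edge

  minSpec≤ : ∀ {v w} → adj G v w ≡ true → minSpec v ≤ α v w
  minSpec≤ {v} vw = min≤member t (colours t v) (colour∈colours t vw)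

  minSpec≤t : ∀ v → minSpec v ≤ t
  minSpec≤t v = min≤⊤ t (colours t v)

  minSpec-attained : ∀ {v w} → adj G v w ≡ true → ∃ λ w' → adj G v w' ≡ true × α v w' ≡ minSpec v
  minSpec-attained {v} {w} vw with argmin-sel id t (colours t v)
  ... | inj₁ min≡t = w , vw , ≤-antisym (subst (α v w ≤_) (sym min≡t) (proj₂ (inRange v w vw))) (minSpec≤ vw)
  ... | inj₂ min∈ with colours-member t min∈
  ...   | inj₁ min≡t = w , vw , ≤-antisym (subst (α v w ≤_) (sym min≡t) (proj₂ (inRange v w vw))) (minSpec≤ vw)
  ...   | inj₂ edge = edge

  minSpec-positive : ∀ {v w} → adj G v w ≡ true → 1 ≤ minSpec v
  minSpec-positive vw with minSpec-attained vw
  ... | w' , vw' , α≡min = subst (1 ≤_) α≡min (proj₁ (inRange _ w' vw'))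

  maxSpec≤maxUSE : ∀ v → maxSpec G α v ≤ maxList (USE G α)
  maxSpec≤maxUSE v = ≤-maxList (USE G α) (∈-map⁺ (maxSpec G α) (∈-allFin v))

  maxUSE≤t : maxList (USE G α) ≤ t
  maxUSE≤t = maxList-lub (USE G α) λ x∈ → case ∈-map⁻ (maxSpec G α) x∈ of λ { (v , _ , refl) → maxSpec≤t v }

  maxUSE-attained : Fin (size G) → ∃ λ v → maxSpec G α v ≡ maxList (USE G α)
  maxUSE-attained v₀ with maxList-sel (USE G α)
  ... | inj₁ max≡0 = v₀ , ≤-antisym (maxSpec≤maxUSE v₀) (subst (_≤ maxSpec G α v₀) (sym max≡0) z≤n)
  ... | inj₂ max∈ with ∈-map⁻ (maxSpec G α) max∈
  ...   | v , _ , max≡ = v , sym max≡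

  continuous⇒contiguous : Continuous (USE G α) → Contiguous (maxSpec G α)
  continuous⇒contiguous continuous k (a , a≤k) (b , k≤b)
    with ∈-map⁻ (maxSpec G α) (continuous k (_ , ∈-map⁺ (maxSpec G α) (∈-allFin a) , a≤k)
                                            (_ , ∈-map⁺ (maxSpec G α) (∈-allFin b) , k≤b))
  ... | c , _ , k≡ = c , sym k≡

eqF-true : ∀ {n} {u v : Fin n} → eqF u v ≡ true → u ≡ v
eqF-true {u = u} {v} eq with u ≟F v
... | yes u≡v = u≡v

orient : ∀ {m} → Fin m → Fin m → Bool
orient u₁ u₂ = toℕ u₁ <ᵇ toℕ u₂

orient-flip : ∀ {m} {u₁ u₂ : Fin m} → u₁ ≢ u₂ → orient u₂ u₁ ≡ not (orient u₁ u₂)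
orient-flip {u₁ = u₁} {u₂} u₁≢u₂ with toℕ u₁ <ᵇ toℕ u₂ in e₁ | toℕ u₂ <ᵇ toℕ u₁ in e₂
... | true  | true  = ⊥-elim (<-asym (<ᵇ⇒< (toℕ u₁) (toℕ u₂) (subst T (sym e₁) tt)) (<ᵇ⇒< (toℕ u₂) (toℕ u₁) (subst T (sym e₂) tt)))
... | true  | false = refl
... | false | true  = refl
... | false | false = ⊥-elim (u₁≢u₂ (toℕ-injective (≤-antisym (≮⇒≥ (not< {toℕ u₂} e₂)) (≮⇒≥ (not< {toℕ u₁} e₁)))))
  where
  not< : ∀ {a b} → (a <ᵇ b) ≡ false → ¬ a < b
  not< e a<b = subst T e (<⇒<ᵇ a<b)

along-flip : ∀ {n} (ψ : Fin n → Fin n → ℕ) b v w → along ψ (not b) w v ≡ along ψ b v w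
along-flip ψ true  v w = refl
along-flip ψ false v w = refl

-- With n = |V(H)|, d = maxSpec H αH, L = max d and
-- a window array ψ for d:
--   * an edge (u, v)(u, w) inside the copy of H at u gets
--         αH(vw) + offset u,        offset u = (min S(u, αG) - 1) · n,
--     so the copy at u occupies the colours (offset u, offset u + d v] at (u, v);
--   * an edge (u, v)(u', w) with uu' ∈ E(G) of colour c gets
--         (c - 1) · n + ψ(v, w)     (ψ read along the row of the endpoint
--                                    first in a fixed order of V(G)),
--     so the G-colours at (u, v) fill the windows (d v, d v + n] shifted by
--     (c - 1) · n for c ∈ S(u, αG), i.e. (offset u + d v, max S(u, αG) · n + d v].

module Composite (G H : Graph) {tG tH : ℕ} {αG : EdgeColoring G} {αH : EdgeColoring H}
                 (IG : IsIntervalColoring G tG αG) (IH : IsIntervalColoring H tH αH)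
                 (contiguous : Contiguous (maxSpec H αH)) (v₀ : Fin (size H)) where

  module IG = IsIntervalColoring IG
  module IH = IsIntervalColoring IH
  module SG = Spectrum G IG
  module SH = Spectrum H IH

  n : ℕ
  n = size H

  instance
    n-nonZero : NonZero n
    n-nonZero = >-nonZero (≤-<-trans z≤n (toℕ<n v₀))

  d : Fin n → ℕ
  d = maxSpec H αH

  L : ℕ
  L = maxList (USE H αH)

  ψ : Fin n → Fin n → ℕ
  ψ = proj₁ (windowArray n d contiguous)

  open Along (proj₂ (windowArray n d contiguous))

  offset : Fin (size G) → ℕ
  offset u = (SG.minSpec u ∸ 1) * n

  Vertex : Set
  Vertex = Fin (size G) × Fin n

  adjacent : Vertex → Vertex → Bool
  adjacent = compAdjPair G H

  colour : Vertex → Vertex → ℕ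
  colour (u₁ , v₁) (u₂ , v₂) =
    if adj G u₁ u₂ then (αG u₁ u₂ ∸ 1) * n + along ψ (orient u₁ u₂) v₁ v₂ else αH v₁ v₂ + offset u₁

  total : ℕ
  total = tG * n + L

  data Edge : Vertex → Vertex → Set where
    between : ∀ {u₁ v₁ u₂ v₂} → adj G u₁ u₂ ≡ true → Edge (u₁ , v₁) (u₂ , v₂)
    inside  : ∀ {u v₁ v₂} → adj H v₁ v₂ ≡ true → Edge (u , v₁) (u , v₂)

  -- (when adj G u₁ u₂ and eqF u₁ u₂ are both false, pq : false ≡ true and the case is empty)
  edge-kind : ∀ p q → adjacent p q ≡ true → Edge p q
  edge-kind (u₁ , v₁) (u₂ , v₂) pq with adj G u₁ u₂ in u₁u₂ | eqF u₁ u₂ in same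
  ... | true  | _     = between u₁u₂
  ... | false | true  with eqF-true {u = u₁} {u₂} same
  ...   | refl = inside pq

  between-adjacent : ∀ {u₁ v₁ u₂ v₂} → adj G u₁ u₂ ≡ true → adjacent (u₁ , v₁) (u₂ , v₂) ≡ true
  between-adjacent u₁u₂ rewrite u₁u₂ = refl

  inside-adjacent : ∀ {u v₁ v₂} → adj H v₁ v₂ ≡ true → adjacent (u , v₁) (u , v₂) ≡ true
  inside-adjacent {u} v₁v₂ rewrite adj-irrefl G u | eqF-refl u | v₁v₂ = refl

  colour-between : ∀ {u₁ v₁ u₂ v₂} → adj G u₁ u₂ ≡ true →
                   colour (u₁ , v₁) (u₂ , v₂) ≡ (αG u₁ u₂ ∸ 1) * n + along ψ (orient u₁ u₂) v₁ v₂
  colour-between u₁u₂ rewrite u₁u₂ = refl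

  colour-inside : ∀ {u v₁ v₂} → colour (u , v₁) (u , v₂) ≡ αH v₁ v₂ + offset u
  colour-inside {u} rewrite adj-irrefl G u = refl

  inside≤ : ∀ {u v w} → adj H v w ≡ true → colour (u , v) (u , w) ≤ offset u + d v
  inside≤ {u} vw = ≤-trans (≤-reflexive colour-inside) (≤-trans (+-monoˡ-≤ _ (SH.≤-maxSpec vw)) (≤-reflexive (+-comm _ (offset u))))

  between> : ∀ {u u' v w} → adj G u u' ≡ true → offset u + d v < colour (u , v) (u' , w)
  between> {u} {u'} {v} uu' = ≤-trans (≤-reflexive (sym (+-suc (offset u) (d v)))) (≤-trans
    (+-mono-≤ (*-monoˡ-≤ n (∸-monoˡ-≤ 1 (SG.minSpec≤ uu'))) (proj₁ (along-window (orient u u') _ _)))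
    (≤-reflexive (sym (colour-between uu'))))

  between≤ : ∀ {u u' v w} → adj G u u' ≡ true → colour (u , v) (u' , w) ≤ αG u u' * n + d v
  between≤ {u} {u'} {v} {w} uu' = begin
      colour (u , v) (u' , w)                             ≡⟨ colour-between uu' ⟩
      (αG u u' ∸ 1) * n + along ψ (orient u u') v w       ≤⟨ +-monoʳ-≤ ((αG u u' ∸ 1) * n) (proj₂ (along-window (orient u u') v w)) ⟩
      (αG u u' ∸ 1) * n + (d v + n)                       ≡⟨ next-block (αG u u' ∸ 1) (d v) n ⟩
      suc (αG u u' ∸ 1) * n + d v                         ≡⟨ cong (λ c → c * n + d v) (suc-∸1 (proj₁ (IG.inRange u u' uu'))) ⟩
      αG u u' * n + d v                                   ∎
    where open ≤-Reasoning

  inside≢between : ∀ {u u' v w w'} → adj H v w ≡ true → adj G u u' ≡ true →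
                   colour (u , v) (u , w) ≢ colour (u , v) (u' , w')
  inside≢between vw uu' eq = <⇒≱ (between> uu') (≤-trans (≤-reflexive (sym eq)) (inside≤ vw))

  adjacent-distinct : ∀ {u₁ u₂} → adj G u₁ u₂ ≡ true → u₁ ≢ u₂
  adjacent-distinct {u₁} u₁u₂ refl = case trans (sym u₁u₂) (adj-irrefl G u₁) of λ ()

  -- both endpoints of an edge between copies read the same entry of ψ
  colour-symmetric : ∀ p q → adjacent p q ≡ true → colour p q ≡ colour q p
  colour-symmetric p q pq with edge-kind p q pq
  ... | between {u₁} {v₁} {u₂} {v₂} u₁u₂ = begin
      colour (u₁ , v₁) (u₂ , v₂)                          ≡⟨ colour-between u₁u₂ ⟩
      (αG u₁ u₂ ∸ 1) * n + along ψ (orient u₁ u₂) v₁ v₂   ≡⟨ cong₂ (λ c x → (c ∸ 1) * n + x) (IG.symmetric u₁ u₂ u₁u₂) flip ⟩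
      (αG u₂ u₁ ∸ 1) * n + along ψ (orient u₂ u₁) v₂ v₁   ≡⟨ colour-between (trans (adj-sym G u₂ u₁) u₁u₂) ⟨
      colour (u₂ , v₂) (u₁ , v₁)                          ∎
    where
    open ≡-Reasoning
    flip : along ψ (orient u₁ u₂) v₁ v₂ ≡ along ψ (orient u₂ u₁) v₂ v₁
    flip = sym (trans (cong (λ b → along ψ b v₂ v₁) (orient-flip (adjacent-distinct u₁u₂)))
                      (along-flip ψ (orient u₁ u₂) v₁ v₂))
  ... | inside {u} {v₁} {v₂} v₁v₂ =
    trans colour-inside (trans (cong (_+ offset u) (IH.symmetric v₁ v₂ v₁v₂)) (sym colour-inside))

  offset≤ : ∀ u → offset u ≤ tG * n
  offset≤ u = *-monoˡ-≤ n (≤-trans (m∸n≤m (SG.minSpec u) 1) (SG.minSpec≤t u))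

  colour-range : ∀ p q → adjacent p q ≡ true → 1 ≤ colour p q × colour p q ≤ total
  colour-range p q pq with edge-kind p q pq
  ... | between {u₁} {v₁} {u₂} {v₂} u₁u₂ =
    ≤-trans (s≤s z≤n) (between> u₁u₂) ,
    ≤-trans (between≤ u₁u₂) (+-mono-≤ (*-monoˡ-≤ n (proj₂ (IG.inRange u₁ u₂ u₁u₂))) (SH.maxSpec≤maxUSE v₁))
  ... | inside {u} {v₁} {v₂} v₁v₂ =
    ≤-trans (proj₁ (IH.inRange v₁ v₂ v₁v₂)) (≤-trans (m≤m+n _ (offset u)) (≤-reflexive (sym colour-inside))) ,
    ≤-trans (inside≤ v₁v₂) (+-mono-≤ (offset≤ u) (SH.maxSpec≤maxUSE v₁))

  -- at (u, v) a colour between copies determines the block, hence the colour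
  -- of uu' (so u' by properness of αG) and then the entry of ψ (so w)
  colour-proper : ∀ p q₁ q₂ → adjacent p q₁ ≡ true → adjacent p q₂ ≡ true → colour p q₁ ≡ colour p q₂ → q₁ ≡ q₂
  colour-proper p q₁ q₂ pq₁ pq₂ eq with edge-kind p q₁ pq₁ | edge-kind p q₂ pq₂
  ... | between {u} {v} {u₁} {w₁} uu₁ | between {u₂ = u₂} {w₂} uu₂ = same-vertex (IG.proper u u₁ u₂ uu₁ uu₂ same-colour)
    where
    eq' : (αG u u₁ ∸ 1) * n + along ψ (orient u u₁) v w₁ ≡ (αG u u₂ ∸ 1) * n + along ψ (orient u u₂) v w₂
    eq' = trans (sym (colour-between uu₁)) (trans eq (colour-between uu₂))
    same-colour : αG u u₁ ≡ αG u u₂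
    same-colour = trans (sym (suc-∸1 (proj₁ (IG.inRange u u₁ uu₁))))
                    (trans (cong suc (block-injective n (d v) eq'
                       (proj₁ (along-window (orient u u₁) v w₁)) (proj₂ (along-window (orient u u₁) v w₁))
                       (proj₁ (along-window (orient u u₂) v w₂)) (proj₂ (along-window (orient u u₂) v w₂))))
                    (suc-∸1 (proj₁ (IG.inRange u u₂ uu₂))))
    same-vertex : u₁ ≡ u₂ → (u₁ , w₁) ≡ (u₂ , w₂)
    same-vertex refl = cong (u₁ ,_) (along-injective (orient u u₁) v w₁ w₂ (+-cancelˡ-≡ ((αG u u₁ ∸ 1) * n) _ _ eq'))
  ... | inside {u} {v} {w₁} vw₁ | inside {v₂ = w₂} vw₂ =
    cong (u ,_) (IH.proper v w₁ w₂ vw₁ vw₂ (+-cancelʳ-≡ (offset u) _ _ (trans (sym colour-inside) (trans eq colour-inside))))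
  ... | between uu₁ | inside vw₂ = ⊥-elim (inside≢between vw₂ uu₁ (sym eq))
  ... | inside vw₁ | between uu₂ = ⊥-elim (inside≢between vw₁ uu₂ eq)

  HasColour : Vertex → ℕ → Set
  HasColour p k = ∃ λ q → adjacent p q ≡ true × colour p q ≡ k

  between-hits : ∀ {u u'} v {r} → adj G u u' ≡ true → r < n →
                 HasColour (u , v) ((αG u u' ∸ 1) * n + suc (d v + r))
  between-hits {u} {u'} v {r} uu' r<n =
    hit (along-fills (orient u u') v (suc (d v + r)) (s≤s (m≤m+n (d v) r)) (below-top (d v) r<n))
    where
    hit : ∃ (λ w → along ψ (orient u u') v w ≡ suc (d v + r)) → HasColour (u , v) ((αG u u' ∸ 1) * n + suc (d v + r))
    hit (w , entry≡) = (u' , w) , between-adjacent uu' , trans (colour-between uu') (cong ((αG u u' ∸ 1) * n +_) entry≡)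

  Used : ℕ → Set
  Used k = ∃ λ p → HasColour p k

  -- colours up to L are used inside the copy of H at an endpoint u₀ of an
  -- edge of colour 1, where offset u₀ = 0
  small-colour-used : ∀ {k} → (∃[ u₀ ] ∃[ u₁ ] (adj G u₀ u₁ ≡ true × αG u₀ u₁ ≡ 1)) →
                      (∃[ v ] ∃[ w ] (adj H v w ≡ true × αH v w ≡ k)) → Used k
  small-colour-used {k} (u₀ , u₁ , u₀u₁ , colour1) (v , w , vw , colourk) =
    (u₀ , v) , (u₀ , w) , inside-adjacent vw , trans colour-inside (trans (cong₂ _+_ colourk no-offset) (+-identityʳ k))
    where
    no-offset : offset u₀ ≡ 0
    no-offset = cong (λ m → (m ∸ 1) * n)
      (≤-antisym (subst (SG.minSpec u₀ ≤_) colour1 (SG.minSpec≤ u₀u₁)) (SG.minSpec-positive u₀u₁))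

  -- the colour q · n + L + 1 + r (r < n) is used between copies, along an
  -- edge of colour q + 1 at a vertex v with d v = L
  large-colour-used : ∀ {q r} → r < n → (∃[ u₁ ] ∃[ u₂ ] (adj G u₁ u₂ ≡ true × αG u₁ u₂ ≡ suc q)) →
                      Used (q * n + suc (L + r))
  large-colour-used {q} {r} r<n (u₁ , u₂ , u₁u₂ , colourq) = at (SH.maxUSE-attained v₀)
    where
    at : ∃ (λ v → d v ≡ L) → Used (q * n + suc (L + r))
    at (vₘ , dvₘ≡L) = (u₁ , vₘ) ,
      subst (HasColour (u₁ , vₘ)) (cong₂ (λ c a → (c ∸ 1) * n + suc (a + r)) colourq dvₘ≡L) (between-hits vₘ u₁u₂ r<n)

  colour-onto : 1 ≤ tG → ∀ k → 1 ≤ k → k ≤ total → Used k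
  colour-onto 1≤tG k 1≤k k≤total with k ≤? L
  ... | yes k≤L = small-colour-used (IG.allUsed 1 ≤-refl 1≤tG) (IH.allUsed k 1≤k (≤-trans k≤L SH.maxUSE≤t))
  ... | no  k≰L = large (split-blocks n L k (≰⇒> k≰L))
    where
    large : ∃ (λ q → ∃ λ r → r < n × q * n + suc (L + r) ≡ k) → Used k
    large (q , r , r<n , k≡) = subst Used k≡ (large-colour-used r<n (IG.allUsed (suc q) (s≤s z≤n) q<tG))
      where
      q<tG : q < tG
      q<tG = ≰⇒> λ tG≤q → <⇒≱ (begin-strict
          tG * n + L          ≤⟨ +-mono-≤ (*-monoˡ-≤ n tG≤q) (m≤m+n L r) ⟩
          q * n + (L + r)     <⟨ +-monoʳ-< (q * n) ≤-refl ⟩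
          q * n + suc (L + r) ≡⟨ k≡ ⟩
          k                   ∎) k≤total
        where open ≤-Reasoning

  low-interval : ∀ {u v q k} → Edge (u , v) q → colour (u , v) q ≤ k → k ≤ offset u + d v → HasColour (u , v) k
  low-interval (between uu') c≤k k≤ = ⊥-elim (<⇒≱ (between> uu') (≤-trans c≤k k≤))
  low-interval {u} {v} {k = k} (inside {v₂ = w} vw) c≤k k≤ =
    shift-up (IH.interval v (αH v w) (d v) (k ∸ offset u) (w , vw , refl) (SH.maxSpec-attained vw)
                (m+n≤o⇒m≤o∸n (αH v w) αH+offset≤k) (m≤n+o⇒m∸n≤o k (offset u) k≤))
    where
    αH+offset≤k : αH v w + offset u ≤ k
    αH+offset≤k = ≤-trans (≤-reflexive (sym colour-inside)) c≤k
    shift-up : InSpectrum H αH v (k ∸ offset u) → HasColour (u , v) k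
    shift-up (w' , vw' , colour≡) = (u , w') , inside-adjacent vw' ,
      trans colour-inside (trans (cong (_+ offset u) colour≡) (m∸n+n≡m (≤-trans (m≤n+m (offset u) _) αH+offset≤k)))

  -- colours above offset u + d v at (u, v) are reached through the edges at u
  -- whose colours run from min S(u, αG) upwards without gaps
  high-interval : ∀ {u v q k} → Edge (u , v) q → k ≤ colour (u , v) q → offset u + d v < k → HasColour (u , v) k
  high-interval (inside vw) k≤c low<k = ⊥-elim (<⇒≱ low<k (≤-trans k≤c (inside≤ vw)))
  high-interval {u} {v} {k = k} (between {u₂ = u₂} uu₂) k≤c low<k =
    from-blocks (split-blocks n (offset u + d v) k low<k)
    where
    m = SG.minSpec u
    1≤m : 1 ≤ m
    1≤m = SG.minSpec-positive uu₂
    from-blocks : ∃ (λ q → ∃ λ r → r < n × q * n + suc (offset u + d v + r) ≡ k) → HasColour (u , v) k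
    from-blocks (q , r , r<n , k≡) =
      reach (IG.interval u m (αG u u₂) (m + q) (SG.minSpec-attained uu₂) (u₂ , uu₂ , refl) (m≤m+n m q) (≮⇒≥ too-far))
      where
      -- if αG(uu₂) < m + q, all colours in the block of uu₂ would be below k
      too-far : αG u u₂ < m + q → ⊥
      too-far c<m+q = <⇒≱ (begin-strict
          colour (u , v) (u₂ , _)          ≤⟨ between≤ uu₂ ⟩
          αG u u₂ * n + d v                ≤⟨ +-monoˡ-≤ (d v) (*-monoˡ-≤ n c≤) ⟩
          (m ∸ 1 + q) * n + d v            ≡⟨ block-shift (m ∸ 1) q n (d v) ⟩
          q * n + (offset u + d v)         <⟨ +-monoʳ-< (q * n) (s≤s (m≤m+n _ r)) ⟩
          q * n + suc (offset u + d v + r) ≡⟨ k≡ ⟩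
          k                                ∎) k≤c
        where
        open ≤-Reasoning
        c≤ : αG u u₂ ≤ m ∸ 1 + q
        c≤ = ≤-pred (≤-trans c<m+q (≤-reflexive (cong (_+ q) (sym (suc-∸1 1≤m)))))
      reach : InSpectrum G αG u (m + q) → HasColour (u , v) k
      reach (u' , uu' , colour≡) = subst (HasColour (u , v)) (begin
          (αG u u' ∸ 1) * n + suc (d v + r)  ≡⟨ cong (λ c → (c ∸ 1) * n + suc (d v + r)) colour≡ ⟩
          (m + q ∸ 1) * n + suc (d v + r)    ≡⟨ cong (λ c → c * n + suc (d v + r)) (+-∸-comm q 1≤m) ⟩
          (m ∸ 1 + q) * n + suc (d v + r)    ≡⟨ block-entry (m ∸ 1) q n (d v) r ⟩
          q * n + suc (offset u + d v + r)   ≡⟨ k≡ ⟩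
          k                                  ∎) (between-hits v uu' r<n)
        where open ≡-Reasoning

  colour-interval : ∀ u v {a b k} → HasColour (u , v) a → HasColour (u , v) b → a ≤ k → k ≤ b → HasColour (u , v) k
  colour-interval u v {k = k} (q₁ , pq₁ , refl) (q₂ , pq₂ , refl) a≤k k≤b with k ≤? offset u + d v
  ... | yes low  = low-interval (edge-kind _ q₁ pq₁) a≤k low
  ... | no  high = high-interval (edge-kind _ q₂ pq₂) k≤b (≰⇒> high)

  pair : Fin (size G * n) → Vertex
  pair = remQuot n

  index : Vertex → Fin (size G * n)
  index = uncurry combine

  pair-index : ∀ p → pair (index p) ≡ p
  pair-index (u , v) = remQuot-combine u v

  pair-injective : ∀ {x y} → pair x ≡ pair y → x ≡ y
  pair-injective {x} {y} eq = trans (sym (combine-remQuot {size G} n x)) (trans (cong index eq) (combine-remQuot {size G} n y))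

  β : EdgeColoring (compose G H)
  β x y = colour (pair x) (pair y)

  lift-colour : ∀ {x k} → HasColour (pair x) k → InSpectrum (compose G H) β x k
  lift-colour {x} (q , pq , colour≡) = index q ,
    subst (λ q' → adjacent (pair x) q' ≡ true) (sym (pair-index q)) pq ,
    subst (λ q' → colour (pair x) q' ≡ _) (sym (pair-index q)) colour≡

  β-interval : 1 ≤ tG → IsIntervalColoring (compose G H) total β
  β-interval 1≤tG = record
    { symmetric = λ x y → colour-symmetric (pair x) (pair y)
    ; inRange   = λ x y → colour-range (pair x) (pair y)
    ; allUsed   = λ k 1≤k k≤total → used (colour-onto 1≤tG k 1≤k k≤total)
    ; proper    = λ x y z xy xz eq → pair-injective (colour-proper (pair x) (pair y) (pair z) xy xz eq)
    ; interval  = λ x a b k (y , xy , a≡) (z , xz , b≡) a≤k k≤b →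
                    lift-colour (colour-interval _ _ (pair y , xy , a≡) (pair z , xz , b≡) a≤k k≤b)
    }
    where
    used : ∀ {k} → Used k → ∃[ x ] ∃[ y ] (adj (compose G H) x y ≡ true × β x y ≡ k)
    used (p , edge) with lift-colour {index p} (subst (λ p' → HasColour p' _) (sym (pair-index p)) edge)
    ... | y , xy , colour≡ = index p , y , xy , colour≡

a-vertex : ∀ (H : Graph) {t α} → 1 ≤ t → IsIntervalColoring H t α → Fin (size H)
a-vertex H 1≤t I = proj₁ (IsIntervalColoring.allUsed I 1 ≤-refl 1≤t)

composition-colouring : (G H : Graph) {tG tH : ℕ} {αG : EdgeColoring G} {αH : EdgeColoring H} →
  1 ≤ tG → IsIntervalColoring G tG αG → 1 ≤ tH → IsIntervalColoring H tH αH → Continuous (USE H αH) →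
  HasIntervalColoring (compose G H) (tG * size H + maxList (USE H αH))
composition-colouring G H 1≤tG IG 1≤tH IH continuous = β , β-interval 1≤tG
  where open Composite G H IG IH (Spectrum.continuous⇒contiguous H IH continuous) (a-vertex H 1≤tH IH)

theorem4 : (G H : Graph) → IntervalColorable G →
    (αH : EdgeColoring H) → (tH : ℕ) → 1 ≤ tH → IsIntervalColoring H tH αH →
    Continuous (USE H αH) →
    IntervalColorable (compose G H) ×
    ((wG wGH : ℕ) → IsW-min G wG → IsW-min (compose G H) wGH →
       wGH ≤ wG * size H + maxList (USE H αH)) ×
    ((WG WGH : ℕ) → IsW-max G WG → IsW-max (compose G H) WGH →
       WG * size H + maxList (USE H αH) ≤ WGH)
theorem4 G H (tG , 1≤tG , _ , IG) αH tH 1≤tH IH continuous =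
  (_ , positive 1≤tG , colouring 1≤tG IG) ,
  (λ { wG wGH (1≤wG , (_ , I) , _) (_ , _ , least) → least _ (positive 1≤wG) (colouring 1≤wG I) }) ,
  (λ { WG WGH (1≤WG , (_ , I) , _) (_ , _ , greatest) → greatest _ (positive 1≤WG) (colouring 1≤WG I) })
  where
  colouring : ∀ {t α} → 1 ≤ t → IsIntervalColoring G t α → HasIntervalColoring (compose G H) (t * size H + maxList (USE H αH))
  colouring 1≤t I = composition-colouring G H 1≤t I 1≤tH IH continuous
  positive : ∀ {t} → 1 ≤ t → 1 ≤ t * size H + maxList (USE H αH)
  positive 1≤t = ≤-trans (*-mono-≤ 1≤t (≤-<-trans z≤n (toℕ<n (a-vertex H 1≤tH IH)))) (m≤m+n _ _)
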